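{- Let $C=\{A,B\}$ be a non-atomic pattern, $A'\preceq A$, $B'\preceq B$ sub-patterns, and $\mathcal{A}\subseteq[n]^{V_A}$, $\mathcal{B}\subseteq[n]^{V_B}$. Let $U\subseteq V_{B'}$ be the union of the vertex sets of the components of $G_{B'}$ disjoint from $V_{A'}$, and let $W\subseteq V_C$ be the union of the vertex sets of the components of $G_C$ disjoint from $V_{A'}\cup V_{B'}$. Then $$\delta(\mathcal{A}\bowtie\mathcal{B})\le\pi_{V_{A'}}(\mathcal{A})\cdot\mu_U(\mathrm{proj}_{V_{B'}}(\mathcal{B}))\cdot\mu_W(\mathcal{A}\bowtie\mathcal{B}).$$
   Context: $V_k=\{v_0,\dots,v_k\}$, $E_k=\{v_iv_{i+1}:0\le i<k\}$. A pattern is a rooted unordered binary tree (internal nodes with two children) with leaves labeled by elements of $E_k$; its pattern graph $G_A=(V_A,E_A)$ has $E_A$ the set of labels and $V_A$ their endpoints; $\{A,B\}$ denotes the pattern whose root has subtrees $A,B$ (so $G_{\{A,B\}}=G_A\cup G_B$); sub-patterns $A'\preceq A$ are subtrees of a node with all descendants. $[n]^V$ = maps $V\to[n]$; $x_S$ restriction; $yz$ combined tuple. For $\mathcal{A}\subseteq[n]^V$: $\delta(\mathcal{A})=|\mathcal{A}|/n^{|V|}$; $\mathrm{proj}_S(\mathcal{A})=\{x_S:x\in\mathcal{A}\}$, $\pi_S(\mathcal{A})=|\mathrm{proj}_S(\mathcal{A})|/n^{|S|}$; $\mu_S(\mathcal{A})=\max_{z\in[n]^{V\setminus S}}|\{y\in[n]^S:yz\in\mathcal{A}\}|/n^{|S|}$.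 Join $\mathcal{A}\bowtie\mathcal{B}=\{x\in[n]^{V\cup W}:x_V\in\mathcal{A},x_W\in\mathcal{B}\}$. -}

module Defs where

open import Data.Nat as ℕ using (ℕ; zero; suc; NonZero; _^_; _⊔_)
open import Data.Nat.Properties using (m^n≢0)
open import Data.Bool using (Bool; true; false; _∧_; _∨_; if_then_else_)
open import Data.Fin using (Fin; zero; suc; inject₁)
open import Data.Fin.Subset using (Subset; _∈_; _∪_; ⁅_⁆; ∣_∣)
open import Data.Maybe using (Maybe; just; nothing)
import Data.Maybe.Properties as MaybeP
import Data.Fin.Properties as FinP
open import Data.Vec using (Vec; []; _∷_; zipWith; lookup)
import Data.Vec.Properties as VecP
open import Data.List using (List; []; _∷_; map; concatMap; foldr)
open import Data.Integer using (+_)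
open import Data.Rational using (ℚ; _/_)
open import Relation.Nullary.Decidable using (⌊_⌋)

-- The path P_k: vertices V_k = {v_0,…,v_k} are  Fin (suc k),
-- edges E_k = {v_i v_{i+1} : 0 ≤ i < k} are  Fin k  (edge i joins
-- vertex  inject₁ i  (= v_i) and vertex  suc i  (= v_{i+1})).

-- Patterns: rooted binary trees, internal nodes have two children,
-- leaves labelled by edges of P_k.  (Unordered trees are represented by
-- ordered ones; the statement quantifies over all of them.)
data Pattern (k : ℕ) : Set where
  leaf : Fin k → Pattern k
  node : Pattern k → Pattern k → Pattern k

infix 4 _⪯_
data _⪯_ {k : ℕ} : Pattern k → Pattern k → Set where
  here  : ∀ {A} → A ⪯ A
  left  : ∀ {A' A B} → A' ⪯ A → A' ⪯ node A B
  right : ∀ {A' A B} → A' ⪯ B → A' ⪯ node A B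

edgesP : ∀ {k} → Pattern k → Subset k
edgesP (leaf e)   = ⁅ e ⁆
edgesP (node A B) = edgesP A ∪ edgesP B

rightEdge : ∀ {k} → Subset k → Fin (suc k) → Bool
rightEdge []      _       = false
rightEdge (b ∷ E) zero    = b
rightEdge (b ∷ E) (suc v) = rightEdge E v

leftEdge : ∀ {k} → Subset k → Fin (suc k) → Bool
leftEdge E zero    = false
leftEdge E (suc e) = lookup E e

endpoints : ∀ {k} → Subset k → Subset (suc k)
endpoints E = Data.Vec.tabulate (λ v → leftEdge E v ∨ rightEdge E v)

verticesP : ∀ {k} → Pattern k → Subset (suc k)
verticesP A = endpoints (edgesP A)

-- For u a vertex of the graph, {w | Conn E u w} is the
-- vertex set of the connected component of u.
data Conn {k : ℕ} (E : Subset k) : Fin (suc k) → Fin (suc k) → Set where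
  stay : ∀ {u} → Conn E u u
  fwd  : ∀ {e w} → e ∈ E → Conn E (suc e) w → Conn E (inject₁ e) w
  bwd  : ∀ {e w} → e ∈ E → Conn E (inject₁ e) w → Conn E (suc e) w

-- Tuples.  A (partial) assignment over V_k with values in [n] = Fin n is
-- a vector  x : Vec (Maybe (Fin n)) (suc k);  x ∈ [n]^S  iff  x is
-- defined exactly on the vertices of S.

Asg : ℕ → ℕ → Set
Asg k n = Vec (Maybe (Fin n)) (suc k)

-- A family 𝒜 ⊆ [n]^V is given by a Boolean characteristic function;
-- relative to a vertex set V it denotes  {x ∈ [n]^V : 𝒜 x ≡ true}.
Fam : ℕ → ℕ → Set
Fam k n = Asg k n → Bool

countB : ∀ {A : Set} → (A → Bool) → List A → ℕ
countB p []       = 0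
countB p (x ∷ xs) = if p x then suc (countB p xs) else countB p xs

anyB : ∀ {A : Set} → (A → Bool) → List A → Bool
anyB p []       = false
anyB p (x ∷ xs) = p x ∨ anyB p xs

maxB : List ℕ → ℕ
maxB = foldr _⊔_ 0

module _ {n : ℕ} where

  tuples : ∀ {m} → Subset m → List (Vec (Maybe (Fin n)) m)
  tuples []          = [] ∷ []
  tuples (true ∷ S)  = concatMap (λ a → map (just a ∷_) (tuples S))
                                 (Data.List.allFin n)
  tuples (false ∷ S) = map (nothing ∷_) (tuples S)

  restrict : ∀ {m} → Subset m → Vec (Maybe (Fin n)) m → Vec (Maybe (Fin n)) m
  restrict S x = zipWith (λ b a → if b then a else nothing) S x

  combine : ∀ {m} → Vec (Maybe (Fin n)) m → Vec (Maybe (Fin n)) m → Vec (Maybe (Fin n)) m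
  combine = zipWith merge
    where
    merge : Maybe (Fin n) → Maybe (Fin n) → Maybe (Fin n)
    merge (just a) _ = just a
    merge nothing  b = b

  _≟A_ : ∀ {m} (x y : Vec (Maybe (Fin n)) m) → _
  _≟A_ = VecP.≡-dec (MaybeP.≡-dec FinP._≟_)

module _ {k n : ℕ} where

  card : Subset (suc k) → Fam k n → ℕ
  card V 𝒜 = countB 𝒜 (tuples {n = n} V)

  proj : Subset (suc k) → Subset (suc k) → Fam k n → Fam k n
  proj V S 𝒜 y = anyB (λ x → 𝒜 x ∧ ⌊ restrict S x ≟A y ⌋) (tuples {n = n} V)

  join : Subset (suc k) → Subset (suc k) → Fam k n → Fam k n → Fam k n
  join V W 𝒜 ℬ x = 𝒜 (restrict V x) ∧ ℬ (restrict W x)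

module _ {k n : ℕ} .{{_ : NonZero n}} where

  δ : Subset (suc k) → Fam k n → ℚ
  δ V 𝒜 = _/_ (+ card V 𝒜) (n ^ ∣ V ∣) {{m^n≢0 n ∣ V ∣}}

  π : Subset (suc k) → Subset (suc k) → Fam k n → ℚ
  π V S 𝒜 = _/_ (+ card S (proj V S 𝒜)) (n ^ ∣ S ∣) {{m^n≢0 n ∣ S ∣}}

  μ : Subset (suc k) → Subset (suc k) → Fam k n → ℚ
  μ V S 𝒜 = _/_
    (+ maxB (map (λ z → card S (λ y → 𝒜 (combine y z)))
                 (tuples {n = n} (V Data.Fin.Subset.─ S))))
    (n ^ ∣ S ∣) {{m^n≢0 n ∣ S ∣}}

module Submission where

open import Defs
open import Data.Nat as ℕ using (ℕ; zero; suc; NonZero; _^_)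
import Data.Nat.Properties as ℕP
open import Data.Bool using (Bool; true; false; _∧_; _∨_)
open import Data.Maybe using (Maybe; just; nothing)
open import Data.Fin using (Fin; zero; suc)
open import Data.Fin.Subset using (Subset; _∈_; _∉_; _⊆_; _∪_; _─_; ∣_∣)
open import Data.Vec using (Vec; []; _∷_; tabulate)
open import Data.Product using (_×_; proj₁; proj₂)
open import Function using (_∘_)
open import Relation.Binary.PropositionalEquality
  using (_≡_; refl; sym; trans; cong; cong₂; subst; subst₂; module ≡-Reasoning)

-- Lemma 10.9, by a double fibring of the join.  Write C = V_A ∪ V_B, X = V_{A'}, Y = V_{B'}.  With Z = C ─ W, T = Z ─ U and
-- R = T ─ X the set C is the disjoint union of W, U, X and R, and
--   |𝒜 ⋈ ℬ| = Σ_{z ∈ [n]^Z} |{w : wz ∈ 𝒜 ⋈ ℬ}|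
--           ≤ maxFibre_W(𝒜 ⋈ ℬ) · |{z ∈ [n]^Z : z_X ∈ proj_X 𝒜, z_Y ∈ proj_Y ℬ}|
--           ≤ maxFibre_W(𝒜 ⋈ ℬ) · maxFibre_U(proj_Y ℬ) · |{t ∈ [n]^T : t_X ∈ proj_X 𝒜}|
--           = maxFibre_W(𝒜 ⋈ ℬ) · maxFibre_U(proj_Y ℬ) · |proj_X 𝒜| · n^|R|,
-- where maxFibre_S is the numerator of μ_S.  Dividing by n^|C| = n^|W| n^|U| n^|X| n^|R| is the claim.

module Combinatorics where

  open import Data.Nat using (_+_; _*_; _≤_; z≤n)
  open import Data.Nat.Tactic.RingSolver using (solve-∀)
  open import Data.Bool.Properties using (∨-zeroʳ; ∨-commutativeMonoid)
  open import Algebra.Bundles using (CommutativeMonoid)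
  open import Algebra.Properties.CommutativeSemigroup ℕP.+-commutativeSemigroup
    using () renaming (interchange to +-interchange)
  open import Algebra.Properties.CommutativeSemigroup
    (CommutativeMonoid.commutativeSemigroup ∨-commutativeMonoid)
    using () renaming (interchange to ∨-interchange)
  open import Data.Empty using (⊥; ⊥-elim)
  open import Data.List using (List; []; _∷_; map; concatMap; _++_; length; allFin)
  import Data.List.Properties as ListP
  import Data.List.Relation.Unary.All as All
  open import Data.List.Relation.Unary.All using (All; []; _∷_)
  import Data.List.Relation.Unary.All.Properties as AllP
  import Data.List.Relation.Unary.Any as Any
  open import Data.List.Relation.Unary.Any using (here; there)
  open import Data.List.Membership.Propositional using () renaming (_∈_ to _∈ᴸ_)
  open import Data.List.Membership.Propositional.Properties using (∈-map⁺; ∈-allFin; ∈-concatMap⁺)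
  open import Data.Vec.Properties using ([]=⇒lookup; lookup⇒[]=; lookup-zipWith; tabulate-cong)
  open import Data.Vec.Relation.Binary.Pointwise.Inductive as Pointwise using (Pointwise; []; _∷_; tabulate⁺)
  open import Data.Vec.Relation.Binary.Pointwise.Extensional using (ext; extensional⇒inductive)
  open import Relation.Nullary.Decidable using (⌊_⌋; isYes≗does; dec-true)

  χ : Bool → ℕ
  χ true  = 1
  χ false = 0

  χ-∧ : ∀ a b → χ (a ∧ b) ≡ χ a * χ b
  χ-∧ true  b = sym (ℕP.*-identityˡ (χ b))
  χ-∧ false b = refl

  χ-absorb : ∀ {b c} → (b ≡ true → c ≡ true) → χ b ≡ χ c * χ b
  χ-absorb {false} {c} _ = sym (ℕP.*-zeroʳ (χ c))
  χ-absorb {true}      h rewrite h refl = refl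

  sumL : ∀ {A : Set} → (A → ℕ) → List A → ℕ
  sumL f []       = 0
  sumL f (x ∷ xs) = f x + sumL f xs

  module _ {A : Set} where

    sumL-++ : (f : A → ℕ) (xs ys : List A) → sumL f (xs ++ ys) ≡ sumL f xs + sumL f ys
    sumL-++ f []       ys = refl
    sumL-++ f (x ∷ xs) ys = trans (cong (f x +_) (sumL-++ f xs ys)) (sym (ℕP.+-assoc (f x) _ _))

    sumL-cong : {f g : A → ℕ} → (∀ x → f x ≡ g x) → ∀ xs → sumL f xs ≡ sumL g xs
    sumL-cong h []       = refl
    sumL-cong h (x ∷ xs) = cong₂ _+_ (h x) (sumL-cong h xs)

    sumL-congᴬ : {P : A → Set} {f g : A → ℕ} → (∀ {x} → P x → f x ≡ g x) →
                 ∀ {xs} → All P xs → sumL f xs ≡ sumL g xs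
    sumL-congᴬ h []         = refl
    sumL-congᴬ h (px ∷ pxs) = cong₂ _+_ (h px) (sumL-congᴬ h pxs)

    sumL-monoᴬ : {P : A → Set} {f g : A → ℕ} → (∀ {x} → P x → f x ≤ g x) →
                 ∀ {xs} → All P xs → sumL f xs ≤ sumL g xs
    sumL-monoᴬ h []         = z≤n
    sumL-monoᴬ h (px ∷ pxs) = ℕP.+-mono-≤ (h px) (sumL-monoᴬ h pxs)

    sumL-+ : (f g : A → ℕ) (xs : List A) → sumL (λ x → f x + g x) xs ≡ sumL f xs + sumL g xs
    sumL-+ f g []       = refl
    sumL-+ f g (x ∷ xs) = trans (cong (f x + g x +_) (sumL-+ f g xs))
                                (+-interchange (f x) (g x) (sumL f xs) (sumL g xs))

    sumL-*ˡ : (c : ℕ) (f : A → ℕ) (xs : List A) → sumL (λ x → c * f x) xs ≡ c * sumL f xs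
    sumL-*ˡ c f []       = sym (ℕP.*-zeroʳ c)
    sumL-*ˡ c f (x ∷ xs) = trans (cong (c * f x +_) (sumL-*ˡ c f xs)) (sym (ℕP.*-distribˡ-+ c (f x) _))

    sumL-*ʳ : (c : ℕ) (f : A → ℕ) (xs : List A) → sumL (λ x → f x * c) xs ≡ sumL f xs * c
    sumL-*ʳ c f xs = trans (sumL-cong (λ x → ℕP.*-comm (f x) c) xs)
                           (trans (sumL-*ˡ c f xs) (ℕP.*-comm c (sumL f xs)))

    sumL-const : (c : ℕ) (xs : List A) → sumL (λ _ → c) xs ≡ length xs * c
    sumL-const c []       = refl
    sumL-const c (x ∷ xs) = cong (c +_) (sumL-const c xs)

    countB-sum : (p : A → Bool) (xs : List A) → countB p xs ≡ sumL (χ ∘ p) xs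
    countB-sum p []       = refl
    countB-sum p (x ∷ xs) with p x
    ... | true  = cong suc (countB-sum p xs)
    ... | false = countB-sum p xs

    maxB-mem : (f : A → ℕ) {x : A} {xs : List A} → x ∈ᴸ xs → f x ≤ maxB (map f xs)
    maxB-mem f           (here refl) = ℕP.m≤m⊔n _ _
    maxB-mem f {xs = y ∷ ys} (there m) = ℕP.≤-trans (maxB-mem f m) (ℕP.m≤n⊔m (f y) _)

    anyB-mem : (p : A → Bool) {x : A} {xs : List A} → x ∈ᴸ xs → p x ≡ true → anyB p xs ≡ true
    anyB-mem p           (here refl) px rewrite px = refl
    anyB-mem p {xs = y ∷ ys} (there m) px rewrite anyB-mem p m px = ∨-zeroʳ (p y)

  module _ {A B : Set} where

    sumL-map : (f : B → ℕ) (g : A → B) (xs : List A) → sumL f (map g xs) ≡ sumL (f ∘ g) xs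
    sumL-map f g []       = refl
    sumL-map f g (x ∷ xs) = cong (f (g x) +_) (sumL-map f g xs)

    sumL-concatMap : (f : B → ℕ) (g : A → List B) (xs : List A) →
                     sumL f (concatMap g xs) ≡ sumL (λ a → sumL f (g a)) xs
    sumL-concatMap f g []       = refl
    sumL-concatMap f g (x ∷ xs) = trans (sumL-++ f (g x) (concatMap g xs))
                                        (cong (sumL f (g x) +_) (sumL-concatMap f g xs))

    sumL-swap : (f : A → B → ℕ) (xs : List A) (ys : List B) →
                sumL (λ a → sumL (f a) ys) xs ≡ sumL (λ b → sumL (λ a → f a b) xs) ys
    sumL-swap f []       ys = sym (trans (sumL-const 0 ys) (ℕP.*-zeroʳ (length ys)))
    sumL-swap f (x ∷ xs) ys = trans (cong (sumL (f x) ys +_) (sumL-swap f xs ys))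
                                    (sym (sumL-+ (f x) (λ b → sumL (λ a → f a b) xs) ys))

  -- Implication and incompatibility of two membership bits; as data they can be case-split on.
  data Implies : Bool → Bool → Set where
    f⇒  : ∀ {b} → Implies false b
    t⇒t : Implies true true

  data Exclusive : Bool → Bool → Set where
    f#  : ∀ {b} → Exclusive false b
    t#f : Exclusive true false

  infix 4 _⊑_ _#_
  _⊑_ : ∀ {m} → Subset m → Subset m → Set
  _⊑_ = Pointwise Implies

  _#_ : ∀ {m} → Subset m → Subset m → Set
  _#_ = Pointwise Exclusive

  ⊑-refl : ∀ {m} {S : Subset m} → S ⊑ S
  ⊑-refl = Pointwise.refl refl′
    where
    refl′ : ∀ {b} → Implies b b
    refl′ {false} = f⇒
    refl′ {true}  = t⇒t

  ⊑-trans : ∀ {m} {S S' S'' : Subset m} → S ⊑ S' → S' ⊑ S'' → S ⊑ S''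
  ⊑-trans = Pointwise.trans trans′
    where
    trans′ : ∀ {a b c} → Implies a b → Implies b c → Implies a c
    trans′ f⇒  _   = f⇒
    trans′ t⇒t t⇒t = t⇒t

  #-sym : ∀ {m} {S S' : Subset m} → S # S' → S' # S
  #-sym = Pointwise.sym sym′
    where
    sym′ : ∀ {a b} → Exclusive a b → Exclusive b a
    sym′ {b = false} _   = f#
    sym′ {b = true}  f#  = t#f

  ⊑-∪ˡ : ∀ {m} (S S' : Subset m) → S ⊑ S ∪ S'
  ⊑-∪ˡ []            []        = []
  ⊑-∪ˡ (false ∷ S) (_ ∷ S')   = f⇒  ∷ ⊑-∪ˡ S S'
  ⊑-∪ˡ (true  ∷ S) (_ ∷ S')   = t⇒t ∷ ⊑-∪ˡ S S'

  ⊑-∪ʳ : ∀ {m} (S S' : Subset m) → S' ⊑ S ∪ S'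
  ⊑-∪ʳ []          []           = []
  ⊑-∪ʳ (_     ∷ S) (false ∷ S') = f⇒  ∷ ⊑-∪ʳ S S'
  ⊑-∪ʳ (false ∷ S) (true  ∷ S') = t⇒t ∷ ⊑-∪ʳ S S'
  ⊑-∪ʳ (true  ∷ S) (true  ∷ S') = t⇒t ∷ ⊑-∪ʳ S S'

  ⊑-# : ∀ {m} {S S' D : Subset m} → S ⊑ S' → S' # D → S # D
  ⊑-# []          []        = []
  ⊑-# (f⇒  ∷ i) (_ ∷ e)   = f#  ∷ ⊑-# i e
  ⊑-# (t⇒t ∷ i) (t#f ∷ e) = t#f ∷ ⊑-# i e

  ⊑-─ : ∀ {m} {S C D : Subset m} → S ⊑ C → S # D → S ⊑ C ─ D
  ⊑-─ []          []        = []
  ⊑-─ (f⇒  ∷ i) (_ ∷ e)   = f⇒  ∷ ⊑-─ i e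
  ⊑-─ (t⇒t ∷ i) (t#f ∷ e) = t⇒t ∷ ⊑-─ i e

  ─-monoˡ : ∀ {m} {S C : Subset m} (D : Subset m) → S ⊑ C → S ─ D ⊑ C ─ D
  ─-monoˡ []           []        = []
  ─-monoˡ (true  ∷ D) (_   ∷ i) = f⇒  ∷ ─-monoˡ D i
  ─-monoˡ (false ∷ D) (f⇒  ∷ i) = f⇒  ∷ ─-monoˡ D i
  ─-monoˡ (false ∷ D) (t⇒t ∷ i) = t⇒t ∷ ─-monoˡ D i

  ─-# : ∀ {m} (C S : Subset m) → C ─ S # S
  ─-# []          []          = []
  ─-# (_     ∷ C) (true  ∷ S) = f#  ∷ ─-# C S
  ─-# (false ∷ C) (false ∷ S) = f#  ∷ ─-# C S
  ─-# (true  ∷ C) (false ∷ S) = t#f ∷ ─-# C S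

  ⊑-split : ∀ {m} {S : Subset m} (C : Subset m) → S ⊑ C → C ≡ S ∪ (C ─ S)
  ⊑-split []          []        = refl
  ⊑-split (c ∷ C) (f⇒  ∷ i) = cong (c ∷_) (⊑-split C i)
  ⊑-split (c ∷ C) (t⇒t ∷ i) = cong (c ∷_) (⊑-split C i)

  card-∪ : ∀ {m} {S S' : Subset m} → S # S' → ∣ S ∪ S' ∣ ≡ ∣ S ∣ + ∣ S' ∣
  card-∪ []                    = refl
  card-∪ {S' = false ∷ _} (f# ∷ e) = card-∪ e
  card-∪ {S' = true  ∷ _} (f# ∷ e) = trans (cong suc (card-∪ e)) (sym (ℕP.+-suc _ _))
  card-∪ (t#f ∷ e)        = cong suc (card-∪ e)

  card-split : ∀ {m} {S : Subset m} (C : Subset m) → S ⊑ C → ∣ C ∣ ≡ ∣ S ∣ + ∣ C ─ S ∣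
  card-split {S = S} C i = trans (cong ∣_∣ (⊑-split C i)) (card-∪ (#-sym (─-# C S)))

  ⊆⇒⊑ : ∀ {m} {S S' : Subset m} → S ⊆ S' → S ⊑ S'
  ⊆⇒⊑ {S = S} h = extensional⇒inductive (ext λ i → bit (λ e → []=⇒lookup (h (lookup⇒[]= i S e))))
    where
    bit : ∀ {a b} → (a ≡ true → b ≡ true) → Implies a b
    bit {false}     _ = f⇒
    bit {true}      h rewrite h refl = t⇒t

  disjoint⇒# : ∀ {m} {S S' : Subset m} → (∀ {i} → i ∈ S → i ∉ S') → S # S'
  disjoint⇒# {S = S} {S'} h =
    extensional⇒inductive (ext λ i → bit (λ e e' → h (lookup⇒[]= i S e) (lookup⇒[]= i S' e')))
    where
    bit : ∀ {a b} → (a ≡ true → b ≡ true → ⊥) → Exclusive a b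
    bit {false}         _ = f#
    bit {true} {false}  _ = t#f
    bit {true} {true}   h = ⊥-elim (h refl refl)

  module _ {n : ℕ} where

    data Supp : ∀ {m} → Subset m → Vec (Maybe (Fin n)) m → Set where
      []  : Supp [] []
      _∷ᵗ_ : ∀ {m S x} (a : Fin n) → Supp {m} S x → Supp (true ∷ S) (just a ∷ x)
      ∷ᶠ_ : ∀ {m S x} → Supp {m} S x → Supp (false ∷ S) (nothing ∷ x)

    tuples-sound : ∀ {m} (S : Subset m) → All (Supp S) (tuples {n = n} S)
    tuples-sound []          = [] ∷ []
    tuples-sound (true ∷ S)  = AllP.concat⁺ (AllP.map⁺ (All.universal
                                 (λ a → AllP.map⁺ (All.map (a ∷ᵗ_) (tuples-sound S))) (allFin n)))
    tuples-sound (false ∷ S) = AllP.map⁺ (All.map ∷ᶠ_ (tuples-sound S))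

    tuples-complete : ∀ {m} {S : Subset m} {x} → Supp S x → x ∈ᴸ tuples {n = n} S
    tuples-complete []       = Any.here refl
    tuples-complete (a ∷ᵗ s) = ∈-concatMap⁺ _ (Any.map (λ { refl → ∈-map⁺ (just a ∷_) (tuples-complete s) })
                                                       (∈-allFin a))
    tuples-complete (∷ᶠ s)   = ∈-map⁺ (nothing ∷_) (tuples-complete s)

    sum-tuples-true : ∀ {m} (S : Subset m) (f : Vec (Maybe (Fin n)) (suc m) → ℕ) →
      sumL f (tuples {n = n} (true ∷ S)) ≡ sumL (λ a → sumL (λ x → f (just a ∷ x)) (tuples S)) (allFin n)
    sum-tuples-true S f = trans (sumL-concatMap f _ (allFin n))
                                (sumL-cong (λ a → sumL-map f (just a ∷_) (tuples S)) (allFin n))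

    sum-tuples-false : ∀ {m} (S : Subset m) (f : Vec (Maybe (Fin n)) (suc m) → ℕ) →
      sumL f (tuples {n = n} (false ∷ S)) ≡ sumL (λ x → f (nothing ∷ x)) (tuples S)
    sum-tuples-false S f = sumL-map f (nothing ∷_) (tuples S)

    sum-const-tuples : ∀ {m} (S : Subset m) (c : ℕ) → sumL (λ _ → c) (tuples {n = n} S) ≡ n ^ ∣ S ∣ * c
    sum-const-tuples []          c = trans (ℕP.+-identityʳ c) (sym (ℕP.*-identityˡ c))
    sum-const-tuples (false ∷ S) c = trans (sum-tuples-false S _) (sum-const-tuples S c)
    sum-const-tuples (true ∷ S)  c = begin
      sumL (λ _ → c) (tuples {n = n} (true ∷ S))
        ≡⟨ sum-tuples-true S _ ⟩
      sumL (λ _ → sumL (λ _ → c) (tuples {n = n} S)) (allFin n)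
        ≡⟨ sumL-cong (λ _ → sum-const-tuples S c) (allFin n) ⟩
      sumL (λ _ → n ^ ∣ S ∣ * c) (allFin n)
        ≡⟨ sumL-const _ (allFin n) ⟩
      length (allFin n) * (n ^ ∣ S ∣ * c)
        ≡⟨ cong (_* (n ^ ∣ S ∣ * c)) (ListP.length-tabulate {n = n} (λ i → i)) ⟩
      n * (n ^ ∣ S ∣ * c)
        ≡⟨ ℕP.*-assoc n _ c ⟨
      n ^ ∣ true ∷ S ∣ * c ∎
      where open ≡-Reasoning

    fubini : ∀ {m} {S S' : Subset m} → S # S' → (f : Vec (Maybe (Fin n)) m → ℕ) →
      sumL f (tuples (S ∪ S')) ≡ sumL (λ y → sumL (λ z → f (combine y z)) (tuples S')) (tuples {n = n} S)
    fubini [] f = sym (ℕP.+-identityʳ _)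
    fubini {S = false ∷ S} {false ∷ S'} (f# ∷ d) f = begin
      sumL f (tuples (false ∷ (S ∪ S')))
        ≡⟨ sum-tuples-false (S ∪ S') f ⟩
      sumL (λ x → f (nothing ∷ x)) (tuples (S ∪ S'))
        ≡⟨ fubini d _ ⟩
      sumL (λ y → sumL (λ z → f (nothing ∷ combine y z)) (tuples S')) (tuples S)
        ≡⟨ sumL-cong (λ y → sum-tuples-false S' _) (tuples S) ⟨
      sumL (λ y → sumL (λ z → f (combine (nothing ∷ y) z)) (tuples (false ∷ S'))) (tuples S)
        ≡⟨ sum-tuples-false S _ ⟨
      sumL (λ y → sumL (λ z → f (combine y z)) (tuples (false ∷ S'))) (tuples (false ∷ S)) ∎
      where open ≡-Reasoning
    fubini {S = false ∷ S} {true ∷ S'} (f# ∷ d) f = begin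
      sumL f (tuples (true ∷ (S ∪ S')))
        ≡⟨ sum-tuples-true (S ∪ S') f ⟩
      sumL (λ a → sumL (λ x → f (just a ∷ x)) (tuples (S ∪ S'))) (allFin n)
        ≡⟨ sumL-cong (λ a → fubini d _) (allFin n) ⟩
      sumL (λ a → sumL (λ y → sumL (λ z → f (just a ∷ combine y z)) (tuples S')) (tuples S)) (allFin n)
        ≡⟨ sumL-swap _ (allFin n) (tuples S) ⟩
      sumL (λ y → sumL (λ a → sumL (λ z → f (just a ∷ combine y z)) (tuples S')) (allFin n)) (tuples S)
        ≡⟨ sumL-cong (λ y → sum-tuples-true S' _) (tuples S) ⟨
      sumL (λ y → sumL (λ z → f (combine (nothing ∷ y) z)) (tuples (true ∷ S'))) (tuples S)
        ≡⟨ sum-tuples-false S _ ⟨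
      sumL (λ y → sumL (λ z → f (combine y z)) (tuples (true ∷ S'))) (tuples (false ∷ S)) ∎
      where open ≡-Reasoning
    fubini {S = true ∷ S} {false ∷ S'} (t#f ∷ d) f = begin
      sumL f (tuples (true ∷ (S ∪ S')))
        ≡⟨ sum-tuples-true (S ∪ S') f ⟩
      sumL (λ a → sumL (λ x → f (just a ∷ x)) (tuples (S ∪ S'))) (allFin n)
        ≡⟨ sumL-cong (λ a → fubini d _) (allFin n) ⟩
      sumL (λ a → sumL (λ y → sumL (λ z → f (just a ∷ combine y z)) (tuples S')) (tuples S)) (allFin n)
        ≡⟨ sumL-cong (λ a → sumL-cong (λ y → sum-tuples-false S' _) (tuples S)) (allFin n) ⟨
      sumL (λ a → sumL (λ y → sumL (λ z → f (combine (just a ∷ y) z)) (tuples (false ∷ S'))) (tuples S)) (allFin n)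
        ≡⟨ sum-tuples-true S _ ⟨
      sumL (λ y → sumL (λ z → f (combine y z)) (tuples (false ∷ S'))) (tuples (true ∷ S)) ∎
      where open ≡-Reasoning

    fibres : ∀ {m} {S : Subset m} (C : Subset m) → S ⊑ C → (f : Vec (Maybe (Fin n)) m → ℕ) →
      sumL f (tuples C) ≡ sumL (λ z → sumL (λ y → f (combine y z)) (tuples S)) (tuples {n = n} (C ─ S))
    fibres {S = S} C S⊑C f = begin
      sumL f (tuples C)
        ≡⟨ cong (sumL f ∘ tuples) (⊑-split C S⊑C) ⟩
      sumL f (tuples (S ∪ (C ─ S)))
        ≡⟨ fubini (#-sym (─-# C S)) f ⟩
      sumL (λ y → sumL (λ z → f (combine y z)) (tuples (C ─ S))) (tuples S)
        ≡⟨ sumL-swap _ (tuples S) (tuples (C ─ S)) ⟩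
      sumL (λ z → sumL (λ y → f (combine y z)) (tuples S)) (tuples (C ─ S)) ∎
      where open ≡-Reasoning

    supp-combine : ∀ {m} {S S' : Subset m} {y z} → Supp S y → Supp S' z → S # S' → Supp (S ∪ S') (combine y z)
    supp-combine []       []        []        = []
    supp-combine (a ∷ᵗ s) (∷ᶠ s')   (t#f ∷ d) = a ∷ᵗ supp-combine s s' d
    supp-combine (∷ᶠ s)   (a ∷ᵗ s') (f#  ∷ d) = a ∷ᵗ supp-combine s s' d
    supp-combine (∷ᶠ s)   (∷ᶠ s')   (f#  ∷ d) = ∷ᶠ supp-combine s s' d

    supp-restrict : ∀ {m} {S S' : Subset m} {x} → Supp S x → S' ⊑ S → Supp S' (restrict S' x)
    supp-restrict []       []        = []
    supp-restrict (a ∷ᵗ s) (f⇒  ∷ i) = ∷ᶠ supp-restrict s i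
    supp-restrict (a ∷ᵗ s) (t⇒t ∷ i) = a ∷ᵗ supp-restrict s i
    supp-restrict (∷ᶠ s)   (f⇒  ∷ i) = ∷ᶠ supp-restrict s i

    restrict-restrict : ∀ {m} {X A : Subset m} → X ⊑ A → (x : Vec (Maybe (Fin n)) m) →
                        restrict X (restrict A x) ≡ restrict X x
    restrict-restrict []        []      = refl
    restrict-restrict (f⇒  ∷ i) (v ∷ x) = cong (nothing ∷_) (restrict-restrict i x)
    restrict-restrict (t⇒t ∷ i) (v ∷ x) = cong (v ∷_) (restrict-restrict i x)

    restrict-combine-own : ∀ {m} {S S' : Subset m} {y z} → Supp S y → Supp S' z → S # S' →
                           restrict S (combine y z) ≡ y
    restrict-combine-own []       []        []        = refl
    restrict-combine-own (a ∷ᵗ s) (∷ᶠ s')   (t#f ∷ d) = cong (just a ∷_) (restrict-combine-own s s' d)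
    restrict-combine-own (∷ᶠ s)   (a ∷ᵗ s') (f#  ∷ d) = cong (nothing ∷_) (restrict-combine-own s s' d)
    restrict-combine-own (∷ᶠ s)   (∷ᶠ s')   (f#  ∷ d) = cong (nothing ∷_) (restrict-combine-own s s' d)

    restrict-combine-outside : ∀ {m} {S X : Subset m} {u} → Supp S u → S # X → (t : Vec (Maybe (Fin n)) m) →
                               restrict X (combine u t) ≡ restrict X t
    restrict-combine-outside []       []        []      = refl
    restrict-combine-outside (a ∷ᵗ s) (t#f ∷ e) (v ∷ t) = cong (nothing ∷_) (restrict-combine-outside s e t)
    restrict-combine-outside (∷ᶠ s)   (f#  ∷ e) (v ∷ t) = cong₂ _∷_ refl (restrict-combine-outside s e t)

    restrict-combine-inside : ∀ {m} {S Y : Subset m} {u} → Supp S u → S ⊑ Y → (t : Vec (Maybe (Fin n)) m) →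
                              restrict Y (combine u t) ≡ combine u (restrict Y t)
    restrict-combine-inside []       []        []      = refl
    restrict-combine-inside (a ∷ᵗ s) (t⇒t ∷ i) (v ∷ t) = cong (just a ∷_) (restrict-combine-inside s i t)
    restrict-combine-inside (∷ᶠ s)   (f⇒  ∷ i) (v ∷ t) = cong₂ _∷_ refl (restrict-combine-inside s i t)

    restrict-outside : ∀ {m} {T U : Subset m} (Y : Subset m) {t} → Supp T t → T # U →
                       restrict Y t ≡ restrict (Y ─ U) t
    restrict-outside []                          []       []        = refl
    restrict-outside                 (b ∷ Y)     (a ∷ᵗ s) (t#f ∷ e) = cong₂ _∷_ refl (restrict-outside Y s e)
    restrict-outside {U = false ∷ U} (b ∷ Y)     (∷ᶠ s) (f# ∷ e) = cong₂ _∷_ refl (restrict-outside Y s e)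
    restrict-outside {U = true  ∷ U} (true ∷ Y)  (∷ᶠ s) (f# ∷ e) = cong₂ _∷_ refl (restrict-outside Y s e)
    restrict-outside {U = true  ∷ U} (false ∷ Y) (∷ᶠ s) (f# ∷ e) = cong₂ _∷_ refl (restrict-outside Y s e)

    supp-split : ∀ {m} {S : Subset m} (C : Subset m) → S ⊑ C → ∀ {y z} → Supp S y → Supp (C ─ S) z →
                 Supp C (combine y z)
    supp-split {S = S} C S⊑C y∈ z∈ =
      subst (λ D → Supp D _) (sym (⊑-split C S⊑C)) (supp-combine y∈ z∈ (#-sym (─-# C S)))

  ∧-elimˡ : ∀ {a b} → a ∧ b ≡ true → a ≡ true
  ∧-elimˡ {true} _ = refl

  ∧-elimʳ : ∀ {a b} → a ∧ b ≡ true → b ≡ true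
  ∧-elimʳ {true} b≡true = b≡true

  ∧-intro : ∀ {a b} → a ≡ true → b ≡ true → a ∧ b ≡ true
  ∧-intro refl b≡true = b≡true

  module _ {k n : ℕ} where

    maxFibre : Subset (suc k) → Subset (suc k) → Fam k n → ℕ
    maxFibre V S 𝒜 = maxB (map (λ z → card S (λ y → 𝒜 (combine y z))) (tuples {n = n} (V ─ S)))

    fibre≤maxFibre : (V S : Subset (suc k)) (𝒜 : Fam k n) {z : Vec (Maybe (Fin n)) (suc k)} →
      Supp (V ─ S) z → sumL (λ y → χ (𝒜 (combine y z))) (tuples {n = n} S) ≤ maxFibre V S 𝒜
    fibre≤maxFibre V S 𝒜 z∈ = ℕP.≤-trans (ℕP.≤-reflexive (sym (countB-sum _ (tuples S))))
                                          (maxB-mem (λ z → card S (λ y → 𝒜 (combine y z))) (tuples-complete z∈))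

    proj-restrict : {V A X : Subset (suc k)} (𝒜 : Fam k n) {x : Vec (Maybe (Fin n)) (suc k)} →
      Supp V x → X ⊑ A → A ⊑ V → 𝒜 (restrict A x) ≡ true → proj A X 𝒜 (restrict X x) ≡ true
    proj-restrict {A = A} {X} 𝒜 {x} x∈ X⊑A A⊑V x∈𝒜 =
      subst (λ y → proj A X 𝒜 y ≡ true) (restrict-restrict X⊑A x)
        (anyB-mem (λ x' → 𝒜 x' ∧ ⌊ restrict X x' ≟A restrict X (restrict A x) ⌋)
          (tuples-complete (supp-restrict x∈ A⊑V))
          (∧-intro x∈𝒜 (trans (isYes≗does eq?) (dec-true eq? refl))))
      where eq? = restrict X (restrict A x) ≟A restrict X (restrict A x)

  edges-mono : ∀ {k} {A' A : Pattern k} → A' ⪯ A → edgesP A' ⊑ edgesP A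
  edges-mono here                      = ⊑-refl
  edges-mono {A = node A B} (left p)  = ⊑-trans (edges-mono p) (⊑-∪ˡ (edgesP A) (edgesP B))
  edges-mono {A = node A B} (right p) = ⊑-trans (edges-mono p) (⊑-∪ʳ (edgesP A) (edgesP B))

  endpoints-mono : ∀ {k} {E E' : Subset k} → E ⊑ E' → endpoints E ⊑ endpoints E'
  endpoints-mono {E = E} {E'} E⊑E' = tabulate⁺ (λ v → ∨-mono (leftEdge-mono v) (rightEdge-mono E⊑E' v))
    where
    ∨-mono : ∀ {a b c d} → Implies a c → Implies b d → Implies (a ∨ b) (c ∨ d)
    ∨-mono f⇒  f⇒              = f⇒
    ∨-mono {c = false} f⇒ t⇒t  = t⇒t
    ∨-mono {c = true}  f⇒ t⇒t  = t⇒t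
    ∨-mono t⇒t _               = t⇒t
    leftEdge-mono : ∀ v → Implies (leftEdge E v) (leftEdge E' v)
    leftEdge-mono zero    = f⇒
    leftEdge-mono (suc e) = Pointwise.lookup E⊑E' e
    rightEdge-mono : ∀ {m} {F F' : Subset m} → F ⊑ F' → ∀ v → Implies (rightEdge F v) (rightEdge F' v)
    rightEdge-mono []        zero    = f⇒
    rightEdge-mono (i ∷ _)   zero    = i
    rightEdge-mono (_ ∷ F⊑F') (suc v) = rightEdge-mono F⊑F' v

  vertices-mono : ∀ {k} {A' A : Pattern k} → A' ⪯ A → verticesP A' ⊑ verticesP A
  vertices-mono p = endpoints-mono (edges-mono p)

  ∪-tabulate : ∀ {m} (f g : Fin m → Bool) → tabulate f ∪ tabulate g ≡ tabulate (λ i → f i ∨ g i)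
  ∪-tabulate {zero}  f g = refl
  ∪-tabulate {suc m} f g = cong ((f zero ∨ g zero) ∷_) (∪-tabulate (λ i → f (suc i)) (λ i → g (suc i)))

  leftEdge-∪ : ∀ {k} (E F : Subset k) v → leftEdge (E ∪ F) v ≡ leftEdge E v ∨ leftEdge F v
  leftEdge-∪ E F zero    = refl
  leftEdge-∪ E F (suc e) = lookup-zipWith _∨_ e E F

  rightEdge-∪ : ∀ {k} (E F : Subset k) v → rightEdge (E ∪ F) v ≡ rightEdge E v ∨ rightEdge F v
  rightEdge-∪ []      []      zero    = refl
  rightEdge-∪ (a ∷ E) (b ∷ F) zero    = refl
  rightEdge-∪ (a ∷ E) (b ∷ F) (suc v) = rightEdge-∪ E F v

  endpoints-∪ : ∀ {k} (E F : Subset k) → endpoints (E ∪ F) ≡ endpoints E ∪ endpoints F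
  endpoints-∪ E F = trans (tabulate-cong endpoint-∪)
    (sym (∪-tabulate (λ v → leftEdge E v ∨ rightEdge E v) (λ v → leftEdge F v ∨ rightEdge F v)))
    where
    endpoint-∪ : ∀ v → leftEdge (E ∪ F) v ∨ rightEdge (E ∪ F) v
                     ≡ (leftEdge E v ∨ rightEdge E v) ∨ (leftEdge F v ∨ rightEdge F v)
    endpoint-∪ v = trans (cong₂ _∨_ (leftEdge-∪ E F v) (rightEdge-∪ E F v))
                         (∨-interchange (leftEdge E v) (leftEdge F v) (rightEdge E v) (rightEdge F v))

  vertices-node : ∀ {k} (A B : Pattern k) → verticesP (node A B) ≡ verticesP A ∪ verticesP B
  vertices-node A B = endpoints-∪ (edgesP A) (edgesP B)

  module JoinCount {k n : ℕ} (VA VB X Y U W : Subset (suc k)) (𝒜 ℬ : Fam k n)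
    (X⊑VA : X ⊑ VA) (Y⊑VB : Y ⊑ VB) (U⊑Y : U ⊑ Y) (U#X : U # X)
    (W⊑C : W ⊑ VA ∪ VB) (W#X : W # X) (W#Y : W # Y) where

    Tuple : Set
    Tuple = Vec (Maybe (Fin n)) (suc k)

    C Z T R : Subset (suc k)
    C = VA ∪ VB
    Z = C ─ W
    T = Z ─ U
    R = T ─ X

    𝒜⋈ℬ proj𝒜 projℬ : Fam k n
    𝒜⋈ℬ  = join VA VB 𝒜 ℬ
    proj𝒜 = proj VA X 𝒜
    projℬ = proj VB Y ℬ

    mW mU : ℕ
    mW = maxFibre C W 𝒜⋈ℬ
    mU = maxFibre Y U projℬ

    G : Fam k n
    G z = proj𝒜 (restrict X z) ∧ projℬ (restrict Y z)

    U⊑Z : U ⊑ Z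
    U⊑Z = ⊑-─ (⊑-trans U⊑Y (⊑-trans Y⊑VB (⊑-∪ʳ VA VB))) (⊑-# U⊑Y (#-sym W#Y))

    X⊑T : X ⊑ T
    X⊑T = ⊑-─ (⊑-─ (⊑-trans X⊑VA (⊑-∪ˡ VA VB)) (#-sym W#X)) (#-sym U#X)

    Y─U⊑T : Y ─ U ⊑ T
    Y─U⊑T = ─-monoˡ U (⊑-─ (⊑-trans Y⊑VB (⊑-∪ʳ VA VB)) (#-sym W#Y))

    join-compatible : {w z : Tuple} → Supp W w → Supp Z z → 𝒜⋈ℬ (combine w z) ≡ true → G z ≡ true
    join-compatible {w} {z} w∈ z∈ wz∈𝒜⋈ℬ = ∧-intro
      (subst (λ y → proj𝒜 y ≡ true) (restrict-combine-outside w∈ W#X z)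
        (proj-restrict 𝒜 wz∈C X⊑VA (⊑-∪ˡ VA VB) (∧-elimˡ wz∈𝒜⋈ℬ)))
      (subst (λ y → projℬ y ≡ true) (restrict-combine-outside w∈ W#Y z)
        (proj-restrict ℬ wz∈C Y⊑VB (⊑-∪ʳ VA VB) (∧-elimʳ wz∈𝒜⋈ℬ)))
      where wz∈C = supp-split C W⊑C w∈ z∈

    -- Step 1: fibres along W have at most mW points, and only compatible base points carry any.
    count-W : card C 𝒜⋈ℬ ≤ sumL (χ ∘ G) (tuples Z) * mW
    count-W = begin
      card C 𝒜⋈ℬ
        ≡⟨ countB-sum 𝒜⋈ℬ (tuples C) ⟩
      sumL (χ ∘ 𝒜⋈ℬ) (tuples C)
        ≡⟨ fibres C W⊑C (χ ∘ 𝒜⋈ℬ) ⟩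
      sumL (λ z → sumL (λ w → χ (𝒜⋈ℬ (combine w z))) (tuples W)) (tuples Z)
        ≤⟨ sumL-monoᴬ fibre-bound (tuples-sound Z) ⟩
      sumL (λ z → χ (G z) * mW) (tuples Z)
        ≡⟨ sumL-*ʳ mW (χ ∘ G) (tuples Z) ⟩
      sumL (χ ∘ G) (tuples Z) * mW ∎
      where
      open ℕP.≤-Reasoning
      fibre-bound : {z : Tuple} → Supp Z z → sumL (λ w → χ (𝒜⋈ℬ (combine w z))) (tuples W) ≤ χ (G z) * mW
      fibre-bound {z} z∈ = begin
        sumL (λ w → χ (𝒜⋈ℬ (combine w z))) (tuples W)
          ≡⟨ sumL-congᴬ (λ w∈ → χ-absorb (join-compatible w∈ z∈)) (tuples-sound W) ⟩
        sumL (λ w → χ (G z) * χ (𝒜⋈ℬ (combine w z))) (tuples W)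
          ≡⟨ sumL-*ˡ (χ (G z)) _ (tuples W) ⟩
        χ (G z) * sumL (λ w → χ (𝒜⋈ℬ (combine w z))) (tuples W)
          ≤⟨ ℕP.*-monoʳ-≤ (χ (G z)) (fibre≤maxFibre C W 𝒜⋈ℬ z∈) ⟩
        χ (G z) * mW ∎

    compatible-split : {u t : Tuple} → Supp U u → Supp T t →
      G (combine u t) ≡ proj𝒜 (restrict X t) ∧ projℬ (combine u (restrict (Y ─ U) t))
    compatible-split {u} {t} u∈ t∈ = cong₂ _∧_
      (cong proj𝒜 (restrict-combine-outside u∈ U#X t))
      (cong projℬ (trans (restrict-combine-inside u∈ U⊑Y t)
                         (cong (combine u) (restrict-outside Y t∈ (─-# Z U)))))

    -- Step 2: compatible points of [n]^Z are counted fibrewise along U; each fibre has at most mU.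
    count-U : sumL (χ ∘ G) (tuples Z) ≤ sumL (λ t → χ (proj𝒜 (restrict X t))) (tuples T) * mU
    count-U = begin
      sumL (χ ∘ G) (tuples Z)
        ≡⟨ fibres Z U⊑Z (χ ∘ G) ⟩
      sumL (λ t → sumL (λ u → χ (G (combine u t))) (tuples U)) (tuples T)
        ≤⟨ sumL-monoᴬ fibre-bound (tuples-sound T) ⟩
      sumL (λ t → χ (proj𝒜 (restrict X t)) * mU) (tuples T)
        ≡⟨ sumL-*ʳ mU _ (tuples T) ⟩
      sumL (λ t → χ (proj𝒜 (restrict X t))) (tuples T) * mU ∎
      where
      open ℕP.≤-Reasoning
      fibre-bound : {t : Tuple} → Supp T t →
                    sumL (λ u → χ (G (combine u t))) (tuples U) ≤ χ (proj𝒜 (restrict X t)) * mU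
      fibre-bound {t} t∈ = begin
        sumL (λ u → χ (G (combine u t))) (tuples U)
          ≡⟨ sumL-congᴬ (λ u∈ → trans (cong χ (compatible-split u∈ t∈)) (χ-∧ (proj𝒜 (restrict X t)) _))
                        (tuples-sound U) ⟩
        sumL (λ u → χ (proj𝒜 (restrict X t)) * χ (projℬ (combine u (restrict (Y ─ U) t)))) (tuples U)
          ≡⟨ sumL-*ˡ (χ (proj𝒜 (restrict X t))) _ (tuples U) ⟩
        χ (proj𝒜 (restrict X t)) * sumL (λ u → χ (projℬ (combine u (restrict (Y ─ U) t)))) (tuples U)
          ≤⟨ ℕP.*-monoʳ-≤ (χ (proj𝒜 (restrict X t))) (fibre≤maxFibre Y U projℬ (supp-restrict t∈ Y─U⊑T)) ⟩
        χ (proj𝒜 (restrict X t)) * mU ∎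

    count-X : sumL (λ t → χ (proj𝒜 (restrict X t))) (tuples T) ≡ n ^ ∣ R ∣ * card X proj𝒜
    count-X = begin
      sumL (λ t → χ (proj𝒜 (restrict X t))) (tuples T)
        ≡⟨ fibres T X⊑T _ ⟩
      sumL (λ r → sumL (λ x → χ (proj𝒜 (restrict X (combine x r)))) (tuples X)) (tuples R)
        ≡⟨ sumL-congᴬ (λ r∈ → sumL-congᴬ (λ x∈ → cong (χ ∘ proj𝒜) (restrict-combine-own x∈ r∈ (#-sym (─-# T X))))
                                          (tuples-sound X))
                      (tuples-sound R) ⟩
      sumL (λ r → sumL (χ ∘ proj𝒜) (tuples X)) (tuples R)
        ≡⟨ sumL-cong (λ _ → sym (countB-sum proj𝒜 (tuples X))) (tuples R) ⟩
      sumL (λ r → card X proj𝒜) (tuples R)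
        ≡⟨ sum-const-tuples R (card X proj𝒜) ⟩
      n ^ ∣ R ∣ * card X proj𝒜 ∎
      where open ≡-Reasoning

    join-count : card C 𝒜⋈ℬ ≤ n ^ ∣ R ∣ * card X proj𝒜 * mU * mW
    join-count = begin
      card C 𝒜⋈ℬ                                             ≤⟨ count-W ⟩
      sumL (χ ∘ G) (tuples Z) * mW                           ≤⟨ ℕP.*-monoˡ-≤ mW count-U ⟩
      sumL (λ t → χ (proj𝒜 (restrict X t))) (tuples T) * mU * mW ≡⟨ cong (λ s → s * mU * mW) count-X ⟩
      n ^ ∣ R ∣ * card X proj𝒜 * mU * mW                      ∎
      where open ℕP.≤-Reasoning

    dimension : ∣ C ∣ ≡ ∣ W ∣ + (∣ U ∣ + (∣ X ∣ + ∣ R ∣))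
    dimension = begin
      ∣ C ∣                              ≡⟨ card-split C W⊑C ⟩
      ∣ W ∣ + ∣ Z ∣                      ≡⟨ cong (∣ W ∣ +_) (card-split Z U⊑Z) ⟩
      ∣ W ∣ + (∣ U ∣ + ∣ T ∣)            ≡⟨ cong (λ s → ∣ W ∣ + (∣ U ∣ + s)) (card-split T X⊑T) ⟩
      ∣ W ∣ + (∣ U ∣ + (∣ X ∣ + ∣ R ∣)) ∎
      where open ≡-Reasoning

    join-count-scaled : card C 𝒜⋈ℬ * (n ^ ∣ X ∣ * n ^ ∣ U ∣ * n ^ ∣ W ∣) ≤ card X proj𝒜 * mU * mW * n ^ ∣ C ∣
    join-count-scaled = begin
      card C 𝒜⋈ℬ * (n ^ ∣ X ∣ * n ^ ∣ U ∣ * n ^ ∣ W ∣)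
        ≤⟨ ℕP.*-monoˡ-≤ _ join-count ⟩
      n ^ ∣ R ∣ * card X proj𝒜 * mU * mW * (n ^ ∣ X ∣ * n ^ ∣ U ∣ * n ^ ∣ W ∣)
        ≡⟨ rearrange (n ^ ∣ R ∣) (card X proj𝒜) mU mW (n ^ ∣ X ∣) (n ^ ∣ U ∣) (n ^ ∣ W ∣) ⟩
      card X proj𝒜 * mU * mW * (n ^ ∣ W ∣ * (n ^ ∣ U ∣ * (n ^ ∣ X ∣ * n ^ ∣ R ∣)))
        ≡⟨ cong (card X proj𝒜 * mU * mW *_) power-split ⟨
      card X proj𝒜 * mU * mW * n ^ ∣ C ∣ ∎
      where
      open ℕP.≤-Reasoning
      rearrange : ∀ r p u w x u' w' → r * p * u * w * (x * u' * w') ≡ p * u * w * (w' * (u' * (x * r)))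
      rearrange = solve-∀
      power-split : n ^ ∣ C ∣ ≡ n ^ ∣ W ∣ * (n ^ ∣ U ∣ * (n ^ ∣ X ∣ * n ^ ∣ R ∣))
      power-split = begin-equality
        n ^ ∣ C ∣
          ≡⟨ cong (n ^_) dimension ⟩
        n ^ (∣ W ∣ + (∣ U ∣ + (∣ X ∣ + ∣ R ∣)))
          ≡⟨ ℕP.^-distribˡ-+-* n ∣ W ∣ _ ⟩
        n ^ ∣ W ∣ * n ^ (∣ U ∣ + (∣ X ∣ + ∣ R ∣))
          ≡⟨ cong (n ^ ∣ W ∣ *_) (ℕP.^-distribˡ-+-* n ∣ U ∣ _) ⟩
        n ^ ∣ W ∣ * (n ^ ∣ U ∣ * n ^ (∣ X ∣ + ∣ R ∣))
          ≡⟨ cong (λ e → n ^ ∣ W ∣ * (n ^ ∣ U ∣ * e)) (ℕP.^-distribˡ-+-* n ∣ X ∣ _) ⟩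
        n ^ ∣ W ∣ * (n ^ ∣ U ∣ * (n ^ ∣ X ∣ * n ^ ∣ R ∣)) ∎

open Combinatorics
open import Data.Integer as ℤ using (ℤ; +_; +≤+)
import Data.Integer.Properties as ℤP
open import Data.Rational using (_/_; _≤_; _*_; toℚᵘ)
import Data.Rational.Properties as ℚP
import Data.Rational.Unnormalised as ℚᵘ
import Data.Rational.Unnormalised.Properties as ℚᵘP
open import Data.Fin.Subset.Properties using (x∈p∪q⁺)
open import Data.Sum using (inj₁; inj₂)
open import Function.Bundles using (_⇔_; Equivalence)

toℚᵘ-/ : (i : ℤ) (D : ℕ) .{{_ : NonZero D}} → toℚᵘ (i / D) ℚᵘ.≃ (i ℚᵘ./ D)
toℚᵘ-/ i (suc d) = ℚP.toℚᵘ-fromℚᵘ (ℚᵘ.mkℚᵘ i d)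

cross-multiply : (N P Q R D A B E : ℕ)
  .{{_ : NonZero D}} .{{_ : NonZero A}} .{{_ : NonZero B}} .{{_ : NonZero E}} →
  N ℕ.* (A ℕ.* B ℕ.* E) ℕ.≤ P ℕ.* Q ℕ.* R ℕ.* D →
  (+ N) / D ≤ (+ P) / A * ((+ Q) / B) * ((+ R) / E)
cross-multiply N P Q R D@(suc d) A@(suc a) B@(suc b) E@(suc e) h = ℚP.toℚᵘ-cancel-≤
  (ℚᵘP.≤-respˡ-≃ (ℚᵘP.≃-sym (toℚᵘ-/ (+ N) D))
  (ℚᵘP.≤-respʳ-≃ (ℚᵘP.≃-sym rhs≃) unnormalised))
  where
  unnormalised : ℚᵘ.mkℚᵘ (+ N) d ℚᵘ.≤ ℚᵘ.mkℚᵘ (+ P) a ℚᵘ.* ℚᵘ.mkℚᵘ (+ Q) b ℚᵘ.* ℚᵘ.mkℚᵘ (+ R) e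
  unnormalised = ℚᵘ.*≤* (subst₂ ℤ._≤_ (ℤP.pos-* N (A ℕ.* B ℕ.* E)) rhs-* (+≤+ h))
    where
    rhs-* : + (P ℕ.* Q ℕ.* R ℕ.* D) ≡ + P ℤ.* + Q ℤ.* + R ℤ.* + D
    rhs-* = trans (ℤP.pos-* (P ℕ.* Q ℕ.* R) D)
                  (cong (ℤ._* + D) (trans (ℤP.pos-* (P ℕ.* Q) R) (cong (ℤ._* + R) (ℤP.pos-* P Q))))
  rhs≃ : toℚᵘ (+ P / A * (+ Q / B) * (+ R / E)) ℚᵘ.≃ ℚᵘ.mkℚᵘ (+ P) a ℚᵘ.* ℚᵘ.mkℚᵘ (+ Q) b ℚᵘ.* ℚᵘ.mkℚᵘ (+ R) e
  rhs≃ = ℚᵘP.≃-trans (ℚP.toℚᵘ-homo-* (+ P / A * (+ Q / B)) (+ R / E))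
           (ℚᵘP.*-cong (ℚᵘP.≃-trans (ℚP.toℚᵘ-homo-* (+ P / A) (+ Q / B))
                                    (ℚᵘP.*-cong (toℚᵘ-/ (+ P) A) (toℚᵘ-/ (+ Q) B)))
                       (toℚᵘ-/ (+ R) E))

lemma10p9 : ∀ {k : ℕ} (n : ℕ) .{{_ : NonZero n}}
    (A B A' B' : Pattern k) → A' ⪯ A → B' ⪯ B →
    (𝒜 ℬ : Fam k n) →
    (U W : Subset (suc k)) →
    (∀ u → (u ∈ U) ⇔ (u ∈ verticesP B' × (∀ w → Conn (edgesP B') u w → w ∉ verticesP A'))) →
    (∀ u → (u ∈ W) ⇔ (u ∈ verticesP (node A B) ×
                       (∀ w → Conn (edgesP (node A B)) u w → w ∉ verticesP A' ∪ verticesP B'))) →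
    δ (verticesP A ∪ verticesP B) (join (verticesP A) (verticesP B) 𝒜 ℬ)
      ≤ π (verticesP A) (verticesP A') 𝒜
        * μ (verticesP B') U (proj (verticesP B) (verticesP B') ℬ)
        * μ (verticesP A ∪ verticesP B) W (join (verticesP A) (verticesP B) 𝒜 ℬ)
lemma10p9 {k} n A B A' B' A'⪯A B'⪯B 𝒜 ℬ U W U-spec W-spec =
  cross-multiply (card C 𝒜⋈ℬ) (card X proj𝒜) mU mW (n ^ ∣ C ∣) (n ^ ∣ X ∣) (n ^ ∣ U ∣) (n ^ ∣ W ∣)
    {{ℕP.m^n≢0 n ∣ C ∣}} {{ℕP.m^n≢0 n ∣ X ∣}} {{ℕP.m^n≢0 n ∣ U ∣}} {{ℕP.m^n≢0 n ∣ W ∣}}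
    join-count-scaled
  where
  X Y : Subset (suc k)
  X = verticesP A'
  Y = verticesP B'
  W-avoids : ∀ {w} → w ∈ W → w ∉ X ∪ Y
  W-avoids {w} w∈W = proj₂ (Equivalence.to (W-spec w) w∈W) w stay
  open JoinCount (verticesP A) (verticesP B) X Y U W 𝒜 ℬ (vertices-mono A'⪯A) (vertices-mono B'⪯B)
    (⊆⇒⊑ λ {u} u∈U → proj₁ (Equivalence.to (U-spec u) u∈U))
    (disjoint⇒# λ {u} u∈U → proj₂ (Equivalence.to (U-spec u) u∈U) u stay)
    (subst (W ⊑_) (vertices-node A B) (⊆⇒⊑ λ {w} w∈W → proj₁ (Equivalence.to (W-spec w) w∈W)))
    (disjoint⇒# λ w∈W w∈X → W-avoids w∈W (x∈p∪q⁺ {p = X} {q = Y} (inj₁ w∈X)))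
    (disjoint⇒# λ w∈W w∈Y → W-avoids w∈W (x∈p∪q⁺ {p = X} {q = Y} (inj₂ w∈Y)))
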